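{- For integers $k\ge 2$ and $m\ge1$ let $h_{k,m}=(1,\underbrace{1,\ldots,1}_{k-1},m,\underbrace{0,\ldots,0}_{k-1})\in\mathbb{Z}^{2k}$ (so $d=2k-1$). Call $h=(h_0,\dots,h_d)$ a solution if $h$ is unimodal, $\Pi(h,h)$ is not unimodal, and, with $s$ the largest index with $h_s\ne0$, $h$ satisfies: (1) $h_1\ge h_d$; (2) $h_2+\cdots+h_i\ge h_{d-1}+\cdots+h_{d-i+1}$ for every $2\le i\le\lfloor d/2\rfloor$; (3) $h_0+\cdots+h_i\le h_s+h_{s-1}+\cdots+h_{s-i}$ for every $0\le i\le\lfloor s/2\rfloor$; (4) if $s=d$, then $h_1\le h_i$ for all $1\le i\le d-1$; (5) if $s\le d-1$, then $h_0+h_1\le h_i+h_{i-1}+\cdots+h_{i-(d-s)}$ for all $1\le i\le d-1$. Then, among all $h_{k,m}$ with $k\le 20$ and $m\le 100$, the solutions are exactly those with: $k=14$, $m=12$; $k=15$, $m\in\{12,13\}$; $k=16$, $m\in\{13,14\}$; $k=17$, $m\in\{13,14,15,16\}$; $k=18$, $m\in\{13,14,15,16,17\}$; $k=19$, $m\in\{14,15,\ldots,20\}$; $k=20$, $m\in\{14,15,\ldots,22\}$.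
   Context: A vector $(a_0,\dots,a_D)$ is unimodal if there is an index $i$ with $a_0\le\cdots\le a_i\ge a_{i+1}\ge\cdots\ge a_D$. For a real vector $h=(h_0,\dots,h_d)$, let $\mathscr{E}(h)(x)=\sum_{i=0}^d h_i\binom{x+d-i}{d}$. For $h$ of length $d+1$ and $h'$ of length $d'+1$, with $D=d+d'$, $\Pi(h,h')=(g_0,\dots,g_D)$ is the unique vector with $\sum_{t\ge0}\mathscr{E}(h)(t)\mathscr{E}(h')(t)x^t=\frac{\sum_{j=0}^Dg_jx^j}{(1-x)^{D+1}}$ as formal power series. -}

module Defs where

open import Data.Nat as ℕ using (ℕ; zero; suc; ⌊_/2⌋) renaming (_+_ to _+ℕ_; _∸_ to _∸ℕ_; _≤_ to _≤ℕ_; _<_ to _<ℕ_)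
open import Data.Nat.Combinatorics using (_C_)
open import Data.Integer using (ℤ; +_; -_; _+_; _*_; _≤_; _≥_)
open import Data.List using (List; []; _∷_; _++_; length; replicate; map; upTo; foldr)
open import Data.Product using (Σ; ∃; _×_; _,_)
open import Data.Sum using (_⊎_)
open import Relation.Binary.PropositionalEquality using (_≡_)
open import Relation.Nullary using (¬_)

-- Vectors are lists of integers; reading index i (0 outside the range).
at : List ℤ → ℕ → ℤ
at []       _       = + 0
at (x ∷ xs) zero    = x
at (x ∷ xs) (suc i) = at xs i

top : List ℤ → ℕ
top h = length h ∸ℕ 1

-- sumRange f a b = f a + f (a+1) + ... + f b   (0 if b < a)
sumRange : (ℕ → ℤ) → ℕ → ℕ → ℤ
sumRange f a b = foldr _+_ (+ 0) (map (λ j → f (a +ℕ j)) (upTo (suc b ∸ℕ a)))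

Unimodal : List ℤ → Set
Unimodal a = ∃ λ i → i ≤ℕ top a
  × (∀ j → j <ℕ i → at a j ≤ at a (suc j))
  × (∀ j → i ≤ℕ j → j <ℕ top a → at a j ≥ at a (suc j))

E : List ℤ → ℕ → ℤ
E h t = sumRange (λ i → at h i * + ((t +ℕ d ∸ℕ i) C d)) 0 d
  where d = top h

sign : ℕ → ℤ
sign zero = + 1
sign (suc n) = - sign n

-- Π(h,h'): g_j is the x^j-coefficient of (1-x)^{D+1} · Σ_t E(h)(t)E(h')(t) x^t,
-- i.e. g_j = Σ_{i=0}^{j} (-1)^i binom(D+1,i) f(j-i), for j = 0..D.
Π : List ℤ → List ℤ → List ℤ
Π h h' = map g (upTo (suc D))
  where
  D = top h +ℕ top h'
  f : ℕ → ℤ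
  f t = E h t * E h' t
  g : ℕ → ℤ
  g j = sumRange (λ i → sign i * + ((suc D) C i) * f (j ∸ℕ i)) 0 j

IsLastNonzero : List ℤ → ℕ → Set
IsLastNonzero h s = s ≤ℕ top h × ¬ (at h s ≡ + 0)
  × (∀ j → s <ℕ j → j ≤ℕ top h → at h j ≡ + 0)

Conditions : List ℤ → ℕ → Set
Conditions h s =
    (at h 1 ≥ at h d)
  × (∀ i → 2 ≤ℕ i → i ≤ℕ ⌊ d /2⌋ →
       sumRange (at h) 2 i ≥ sumRange (at h) (d ∸ℕ i +ℕ 1) (d ∸ℕ 1))
  × (∀ i → i ≤ℕ ⌊ s /2⌋ →
       sumRange (at h) 0 i ≤ sumRange (at h) (s ∸ℕ i) s)
  × (s ≡ d → ∀ i → 1 ≤ℕ i → i ≤ℕ d ∸ℕ 1 → at h 1 ≤ at h i)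
  × (s ≤ℕ d ∸ℕ 1 → ∀ i → 1 ≤ℕ i → i ≤ℕ d ∸ℕ 1 →
       at h 0 + at h 1 ≤ sumRange (at h) (i ∸ℕ (d ∸ℕ s)) i)
  where d = top h

Solution : List ℤ → Set
Solution h = Unimodal h × ¬ Unimodal (Π h h)
  × ∃ λ s → IsLastNonzero h s × Conditions h s

hkm : ℕ → ℕ → List ℤ
hkm k m = (+ 1 ∷ replicate (k ∸ℕ 1) (+ 1)) ++ (+ m ∷ replicate (k ∸ℕ 1) (+ 0))

Listed : ℕ → ℕ → Set
Listed k m =
    (k ≡ 14 × m ≡ 12)
  ⊎ (k ≡ 15 × 12 ≤ℕ m × m ≤ℕ 13)
  ⊎ (k ≡ 16 × 13 ≤ℕ m × m ≤ℕ 14)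
  ⊎ (k ≡ 17 × 13 ≤ℕ m × m ≤ℕ 16)
  ⊎ (k ≡ 18 × 13 ≤ℕ m × m ≤ℕ 17)
  ⊎ (k ≡ 19 × 14 ≤ℕ m × m ≤ℕ 20)
  ⊎ (k ≡ 20 × 14 ≤ℕ m × m ≤ℕ 22)

{-# OPTIONS --safe #-}
module Submission where

-- h_{k,m} = u + m e with u = h_{k,0} and e the k-th unit vector. E is linear and Π is
-- bilinear, so Π(h_{k,m}, h_{k,m}) = (Π(u,u) + m Π(u,e)) + m (Π(u,e) + m Π(e,e)) is a
-- quadratic polynomial in m with three fixed coefficient vectors. Once these are computed
-- for each k, every one of the 1900 cases is a finite check on explicit integer vectors
-- (unimodality, and the conditions for the last nonzero index s = k), which is decided by
-- evaluation.

open import Defs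
open import Data.Nat as ℕ using (ℕ; zero; suc; _≤_; _<_; z≤n; s≤s; ⌊_/2⌋)
open import Function.Bundles using (_⇔_; mk⇔)

import Data.Bool.Properties as Bool
open import Data.Empty using (⊥-elim)
open import Data.Integer as ℤ using (ℤ; +_; _+_; _*_)
import Data.Integer.Properties as ℤₚ
open import Data.Integer.Tactic.RingSolver using (solve-∀)
open import Data.List.Base
  using (List; []; _∷_; _++_; length; replicate; map; zipWith; foldr; upTo; applyUpTo)
import Data.List.Properties as List
open import Data.List.Relation.Unary.All.Properties using (applyUpTo⁺₁)
open import Data.Nat.Combinatorics using (_C_)
import Data.Nat.Properties as ℕₚ
open import Data.Product.Base using (_×_; _,_; ∃)
open import Function.Base using (_∘_; id)
import Function.Properties.Equivalence as ⇔
open import Relation.Binary.PropositionalEquality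
  using (_≡_; refl; sym; trans; cong; cong₂; subst; subst₂; module ≡-Reasoning)
open import Relation.Nullary
  using (¬_; Dec; yes; no; does; map′; ¬?; _×-dec_; _⊎-dec_; _→-dec_)
import Relation.Nullary.Decidable as Dec
open import Relation.Unary using (Pred; Decidable)

open ≡-Reasoning

all≤? : ∀ {p} {P : Pred ℕ p} → Decidable P → ∀ n → Dec (∀ i → i ≤ n → P i)
all≤? P? n = map′ (λ f i i≤n → f (s≤s i≤n)) (λ f {i} i<1+n → f i (ℕₚ.≤-pred i<1+n))
                  (ℕₚ.allUpTo? P? (suc n))

allBetween? : ∀ {p} {P : Pred ℕ p} → Decidable P → ∀ lo hi →
              Dec (∀ i → lo ≤ i → i ≤ hi → P i)
allBetween? P? lo hi =
  map′ (λ f i lo≤i i≤hi → f i i≤hi lo≤i) (λ f i i≤hi lo≤i → f i lo≤i i≤hi)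
       (all≤? (λ i → lo ℕ.≤? i →-dec P? i) hi)

⇔-from-does : ∀ {a b} {A : Set a} {B : Set b} (a? : Dec A) (b? : Dec B) →
              does a? ≡ does b? → A ⇔ B
⇔-from-does (yes a)  (yes b)  _  = mk⇔ (λ _ → b) (λ _ → a)
⇔-from-does (no ¬a)  (no ¬b)  _  = mk⇔ (⊥-elim ∘ ¬a) (⊥-elim ∘ ¬b)
⇔-from-does (yes _)  (no _)   ()
⇔-from-does (no _)   (yes _)  ()

∑ : List ℤ → ℤ
∑ = foldr _+_ (+ 0)

∑-map-linear : ∀ {A : Set} (f g : A → ℤ) c xs →
               ∑ (map (λ x → f x + c * g x) xs) ≡ ∑ (map f xs) + c * ∑ (map g xs)
∑-map-linear f g c []       = sym (trans (ℤₚ.+-identityˡ _) (ℤₚ.*-zeroʳ c))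
∑-map-linear f g c (x ∷ xs) = begin
  (f x + c * g x) + ∑ (map (λ x → f x + c * g x) xs)
    ≡⟨ cong (_+_ (f x + c * g x)) (∑-map-linear f g c xs) ⟩
  (f x + c * g x) + (F + c * G)
    ≡⟨ regroup (f x) (g x) F G c ⟩
  (f x + F) + c * (g x + G) ∎
  where
  F = ∑ (map f xs)
  G = ∑ (map g xs)
  regroup : ∀ a b F G c → (a + c * b) + (F + c * G) ≡ (a + F) + c * (b + G)
  regroup = solve-∀

sumRange-linear : ∀ f g c a b →
                  sumRange (λ i → f i + c * g i) a b ≡ sumRange f a b + c * sumRange g a b
sumRange-linear f g c a b = ∑-map-linear _ _ c (upTo (suc b ℕ.∸ a))

sumRange-cong : ∀ {f g} b → (∀ i → i ≤ b → f i ≡ g i) → sumRange f 0 b ≡ sumRange g 0 b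
sumRange-cong b f≗g =
  cong ∑ (List.map-cong-local (applyUpTo⁺₁ id (suc b) (f≗g _ ∘ ℕₚ.≤-pred)))

ascentLength : (ℕ → ℤ) → ℕ → ℕ
ascentLength a zero    = zero
ascentLength a (suc n) with a 0 ℤ.≤? a 1
... | yes _ = suc (ascentLength (a ∘ suc) n)
... | no _  = zero

ascentLength-≤ : ∀ a n → ascentLength a n ≤ n
ascentLength-≤ a zero    = z≤n
ascentLength-≤ a (suc n) with a 0 ℤ.≤? a 1
... | yes _ = s≤s (ascentLength-≤ (a ∘ suc) n)
... | no _  = z≤n

ascentLength-ascending : ∀ a n {j} → j < ascentLength a n → a j ℤ.≤ a (suc j)
ascentLength-ascending a (suc n) {j} j<l with a 0 ℤ.≤? a 1 | j
... | yes a₀≤a₁ | zero  = a₀≤a₁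
... | yes _     | suc j = ascentLength-ascending (a ∘ suc) n (ℕₚ.≤-pred j<l)

ascentLength-maximal : ∀ a n → ascentLength a n < n →
                       ¬ (a (ascentLength a n) ℤ.≤ a (suc (ascentLength a n)))
ascentLength-maximal a (suc n) l<n with a 0 ℤ.≤? a 1
... | yes _     = ascentLength-maximal (a ∘ suc) n (ℕₚ.≤-pred l<n)
... | no a₀≰a₁ = a₀≰a₁

DescendingFrom : (ℕ → ℤ) → ℕ → ℕ → Set
DescendingFrom a p n = ∀ {j} → j < n → p ≤ j → a (suc j) ℤ.≤ a j

unimodal⇔descendingAfterAscent :
  ∀ xs → Unimodal xs ⇔ DescendingFrom (at xs) (ascentLength (at xs) (top xs)) (top xs)
unimodal⇔descendingAfterAscent xs = mk⇔ descending unimodal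
  where
  a = at xs
  n = top xs
  p = ascentLength a n

  descending : Unimodal xs → DescendingFrom a p n
  descending (i , i≤n , asc , desc) {j} j<n p≤j with i ℕ.≤? p
  ... | yes i≤p = desc j (ℕₚ.≤-trans i≤p p≤j) j<n
  ... | no  i≰p = ⊥-elim (ascentLength-maximal a n (ℕₚ.<-≤-trans p<i i≤n) (asc p p<i))
    where p<i = ℕₚ.≰⇒> i≰p

  unimodal : DescendingFrom a p n → Unimodal xs
  unimodal desc = p , ascentLength-≤ a n , (λ j → ascentLength-ascending a n)
                , (λ j p≤j j<n → desc j<n p≤j)

descendingFrom? : ∀ a p n → Dec (DescendingFrom a p n)
descendingFrom? a p n = ℕₚ.allUpTo? (λ j → p ℕ.≤? j →-dec a (suc j) ℤ.≤? a j) n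

-- The ascent length is an argument of descendingFrom?, hence computed once, not once per index.
unimodal? : ∀ xs → Dec (Unimodal xs)
unimodal? xs = Dec.map (⇔.sym (unimodal⇔descendingAfterAscent xs))
  (descendingFrom? (at xs) (ascentLength (at xs) (top xs)) (top xs))

record IsLinearCombination (h u : List ℤ) (c : ℤ) (e : List ℤ) : Set where
  field
    top-u : top u ≡ top h
    top-e : top e ≡ top h
    at-h  : ∀ i → at h i ≡ at u i + c * at e i

Eᵈ : ℕ → List ℤ → ℕ → ℤ
Eᵈ d h t = sumRange (λ i → at h i * + ((t ℕ.+ d ℕ.∸ i) C d)) 0 d

E-linear : ∀ {h u c e} → IsLinearCombination h u c e → ∀ t → E h t ≡ E u t + c * E e t
E-linear {h} {u} {c} {e} lc t = begin
  E h t
    ≡⟨ sumRange-cong d (λ i _ → distrib i) ⟩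
  sumRange (λ i → at u i * B i + c * (at e i * B i)) 0 d
    ≡⟨ sumRange-linear (λ i → at u i * B i) (λ i → at e i * B i) c 0 d ⟩
  Eᵈ d u t + c * Eᵈ d e t
    ≡⟨ cong₂ (λ d₁ d₂ → Eᵈ d₁ u t + c * Eᵈ d₂ e t) (sym top-u) (sym top-e) ⟩
  E u t + c * E e t ∎
  where
  open IsLinearCombination lc
  d = top h
  B : ℕ → ℤ
  B i = + ((t ℕ.+ d ℕ.∸ i) C d)
  expand : ∀ x c y b → (x + c * y) * b ≡ x * b + c * (y * b)
  expand = solve-∀
  distrib : ∀ i → at h i * B i ≡ at u i * B i + c * (at e i * B i)
  distrib i = trans (cong (_* B i) (at-h i)) (expand (at u i) c (at e i) (B i))

ΠCoefficient : ℕ → (ℕ → ℤ) → ℕ → ℤ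
ΠCoefficient D f j = sumRange (λ i → sign i * + ((suc D) C i) * f (j ℕ.∸ i)) 0 j

ΠOf : ℕ → (ℕ → ℤ) → List ℤ
ΠOf D f = map (ΠCoefficient D f) (upTo (suc D))

Π≡ΠOf : ∀ h h' {D} → top h ℕ.+ top h' ≡ D → Π h h' ≡ ΠOf D (λ t → E h t * E h' t)
Π≡ΠOf h h' refl = refl

ΠOf-cong : ∀ D {f g} → (∀ t → t ≤ D → f t ≡ g t) → ΠOf D f ≡ ΠOf D g
ΠOf-cong D f≗g = List.map-cong-local (applyUpTo⁺₁ id (suc D) λ {j} j<1+D →
  sumRange-cong j λ i _ → cong (sign i * + ((suc D) C i) *_)
    (f≗g (j ℕ.∸ i) (ℕₚ.≤-trans (ℕₚ.m∸n≤m j i) (ℕₚ.≤-pred j<1+D))))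

infixl 6 _+[_]_

_+[_]_ : List ℤ → ℤ → List ℤ → List ℤ
xs +[ c ] ys = zipWith (λ x y → x + c * y) xs ys

zipWith-map-map : ∀ {A B C D : Set} (F : B → C → D) (f : A → B) (g : A → C) xs →
                  zipWith F (map f xs) (map g xs) ≡ map (λ x → F (f x) (g x)) xs
zipWith-map-map F f g []       = refl
zipWith-map-map F f g (x ∷ xs) = cong (F (f x) (g x) ∷_) (zipWith-map-map F f g xs)

ΠOf-linear : ∀ D f g c → ΠOf D (λ t → f t + c * g t) ≡ ΠOf D f +[ c ] ΠOf D g
ΠOf-linear D f g c = begin
  map (ΠCoefficient D (λ t → f t + c * g t)) js
    ≡⟨ List.map-cong coefficient-linear js ⟩
  map (λ j → ΠCoefficient D f j + c * ΠCoefficient D g j) js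
    ≡⟨ zipWith-map-map _ _ _ js ⟨
  ΠOf D f +[ c ] ΠOf D g ∎
  where
  js = upTo (suc D)
  w : ℕ → ℤ
  w i = sign i * + ((suc D) C i)
  distrib : ∀ w a c b → w * (a + c * b) ≡ w * a + c * (w * b)
  distrib = solve-∀
  coefficient-linear : ∀ j → ΠCoefficient D (λ t → f t + c * g t) j
                           ≡ ΠCoefficient D f j + c * ΠCoefficient D g j
  coefficient-linear j =
    trans (sumRange-cong j λ i _ → distrib (w i) (f (j ℕ.∸ i)) c (g (j ℕ.∸ i)))
          (sumRange-linear (λ i → w i * f (j ℕ.∸ i)) (λ i → w i * g (j ℕ.∸ i)) c 0 j)

Π-square : ∀ {h u c e} → IsLinearCombination h u c e →
           Π h h ≡ (Π u u +[ c ] Π u e) +[ c ] (Π u e +[ c ] Π e e)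
Π-square {h} {u} {c} {e} lc = begin
  Π h h
    ≡⟨ ΠOf-cong D (λ t _ → square t) ⟩
  ΠOf D (λ t → (uu t + c * ue t) + c * (ue t + c * ee t))
    ≡⟨ ΠOf-linear D (λ t → uu t + c * ue t) (λ t → ue t + c * ee t) c ⟩
  ΠOf D (λ t → uu t + c * ue t) +[ c ] ΠOf D (λ t → ue t + c * ee t)
    ≡⟨ cong₂ _+[ c ]_ (ΠOf-linear D uu ue c) (ΠOf-linear D ue ee c) ⟩
  (ΠOf D uu +[ c ] ΠOf D ue) +[ c ] (ΠOf D ue +[ c ] ΠOf D ee)
    ≡⟨ cong₂ _+[ c ]_ (cong₂ _+[ c ]_ Πuu Πue) (cong₂ _+[ c ]_ Πue Πee) ⟨
  (Π u u +[ c ] Π u e) +[ c ] (Π u e +[ c ] Π e e) ∎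
  where
  open IsLinearCombination lc
  D = top h ℕ.+ top h
  uu ue ee : ℕ → ℤ
  uu t = E u t * E u t
  ue t = E u t * E e t
  ee t = E e t * E e t
  expand : ∀ a c b →
           (a + c * b) * (a + c * b) ≡ (a * a + c * (a * b)) + c * (a * b + c * (b * b))
  expand = solve-∀
  square : ∀ t → E h t * E h t ≡ (uu t + c * ue t) + c * (ue t + c * ee t)
  square t = trans (cong (λ x → x * x) (E-linear lc t)) (expand (E u t) c (E e t))
  Πuu : Π u u ≡ ΠOf D uu
  Πuu = Π≡ΠOf u u (cong₂ ℕ._+_ top-u top-u)
  Πue : Π u e ≡ ΠOf D ue
  Πue = Π≡ΠOf u e (cong₂ ℕ._+_ top-u top-e)
  Πee : Π e e ≡ ΠOf D ee
  Πee = Π≡ΠOf e e (cong₂ ℕ._+_ top-e top-e)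

at-applyUpTo : ∀ f {n t} → t < n → at (applyUpTo f n) t ≡ f t
at-applyUpTo f {suc n} {zero}  _         = refl
at-applyUpTo f {suc n} {suc t} (s≤s t<n) = at-applyUpTo (f ∘ suc) t<n

ΠOfTables : ℕ → List ℤ → List ℤ → List ℤ
ΠOfTables D A B = ΠOf D (λ t → at A t * at B t)

Π-tabulated : ∀ a b {D n} → top a ℕ.+ top b ≡ D → D < n →
              Π a b ≡ ΠOfTables D (applyUpTo (E a) n) (applyUpTo (E b) n)
Π-tabulated a b D≡ D<n = trans (Π≡ΠOf a b D≡) (ΠOf-cong _ λ t t≤D →
  let t<n = ℕₚ.≤-<-trans t≤D D<n in
  sym (cong₂ _*_ (at-applyUpTo (E a) t<n) (at-applyUpTo (E b) t<n)))

QuadraticΠ : (u e P₀ P₁ P₂ : List ℤ) → Set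
QuadraticΠ u e P₀ P₁ P₂ = Π u u ≡ P₀ × Π u e ≡ P₁ × Π e e ≡ P₂

tabulatedQuadraticΠ : ∀ u e → top e ≡ top u → ∀ {Tu Te} → let D = top u ℕ.+ top u in
  applyUpTo (E u) (suc D) ≡ Tu → applyUpTo (E e) (suc D) ≡ Te →
  QuadraticΠ u e (ΠOfTables D Tu Tu) (ΠOfTables D Tu Te) (ΠOfTables D Te Te)
tabulatedQuadraticΠ u e e≡u Tu≡ Te≡ =
    trans (Π-tabulated u u refl ℕₚ.≤-refl) (cong₂ (ΠOfTables _) Tu≡ Tu≡)
  , trans (Π-tabulated u e (cong (top u ℕ.+_) e≡u) ℕₚ.≤-refl) (cong₂ (ΠOfTables _) Tu≡ Te≡)
  , trans (Π-tabulated e e (cong₂ ℕ._+_ e≡u e≡u) ℕₚ.≤-refl) (cong₂ (ΠOfTables _) Te≡ Te≡)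

unimodalΠ? : ∀ {h u c e P₀ P₁ P₂} → IsLinearCombination h u c e → QuadraticΠ u e P₀ P₁ P₂ →
             Dec (Unimodal (Π h h))
unimodalΠ? {h} {u} {c} {e} {P₀} {P₁} {P₂} lc (Πuu≡ , Πue≡ , Πee≡) =
  map′ (subst Unimodal (sym Πhh≡)) (subst Unimodal Πhh≡) (unimodal? P)
  where
  P = (P₀ +[ c ] P₁) +[ c ] (P₁ +[ c ] P₂)
  Πhh≡ : Π h h ≡ P
  Πhh≡ = trans (Π-square lc)
    (cong₂ _+[ c ]_ (cong₂ _+[ c ]_ Πuu≡ Πue≡) (cong₂ _+[ c ]_ Πue≡ Πee≡))

isLastNonzero? : ∀ h s → Dec (IsLastNonzero h s)
isLastNonzero? h s = s ℕ.≤? top h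
               ×-dec ¬? (at h s ℤ.≟ + 0)
               ×-dec allBetween? (λ j → at h j ℤ.≟ + 0) (suc s) (top h)

conditions? : ∀ h s → Dec (Conditions h s)
conditions? h s =
        at h d ℤ.≤? at h 1
  ×-dec allBetween? (λ i → sumRange (at h) (d ℕ.∸ i ℕ.+ 1) (d ℕ.∸ 1) ℤ.≤? sumRange (at h) 2 i)
                    2 ⌊ d /2⌋
  ×-dec all≤? (λ i → sumRange (at h) 0 i ℤ.≤? sumRange (at h) (s ℕ.∸ i) s) ⌊ s /2⌋
  ×-dec (s ℕ.≟ d →-dec allBetween? (λ i → at h 1 ℤ.≤? at h i) 1 (d ℕ.∸ 1))
  ×-dec (s ℕ.≤? d ℕ.∸ 1 →-dec
           allBetween? (λ i → at h 0 + at h 1 ℤ.≤? sumRange (at h) (i ℕ.∸ (d ℕ.∸ s)) i)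
                       1 (d ℕ.∸ 1))
  where d = top h

solution? : ∀ h → Dec (Unimodal (Π h h)) → Dec (Solution h)
solution? h unimodalΠ? = unimodal? h ×-dec ¬? unimodalΠ? ×-dec lastNonzero?
  where
  lastNonzero? : Dec (∃ λ s → IsLastNonzero h s × Conditions h s)
  lastNonzero? =
    map′ (λ (s , _ , P) → s , P) (λ (s , L@(s≤d , _) , C) → s , s≤s s≤d , L , C)
         (ℕₚ.anyUpTo? (λ s → isLastNonzero? h s ×-dec conditions? h s) (suc (top h)))

listed? : ∀ k m → Dec (Listed k m)
listed? k m =
        k ℕ.≟ 14 ×-dec m ℕ.≟ 12
  ⊎-dec k ℕ.≟ 15 ×-dec 12 ℕ.≤? m ×-dec m ℕ.≤? 13
  ⊎-dec k ℕ.≟ 16 ×-dec 13 ℕ.≤? m ×-dec m ℕ.≤? 14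
  ⊎-dec k ℕ.≟ 17 ×-dec 13 ℕ.≤? m ×-dec m ℕ.≤? 16
  ⊎-dec k ℕ.≟ 18 ×-dec 13 ℕ.≤? m ×-dec m ℕ.≤? 17
  ⊎-dec k ℕ.≟ 19 ×-dec 14 ℕ.≤? m ×-dec m ℕ.≤? 20
  ⊎-dec k ℕ.≟ 20 ×-dec 14 ℕ.≤? m ×-dec m ℕ.≤? 22

basisVector : ℕ → ℕ → List ℤ
basisVector i n = replicate i (+ 0) ++ (+ 1 ∷ replicate n (+ 0))

at-replicate-0 : ∀ n i → at (replicate n (+ 0)) i ≡ + 0
at-replicate-0 zero    i       = refl
at-replicate-0 (suc n) zero    = refl
at-replicate-0 (suc n) (suc i) = at-replicate-0 n i

++-∷-linearCombination : ∀ p x q →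
  IsLinearCombination (p ++ (x ∷ q)) (p ++ (+ 0 ∷ q)) x (basisVector (length p) (length q))
++-∷-linearCombination p x q = record
  { top-u = cong (ℕ._∸ 1) (trans (List.length-++ p) (sym (List.length-++ p)))
  ; top-e = cong (ℕ._∸ 1) (begin
      length (basisVector (length p) (length q))
        ≡⟨ List.length-++ (replicate (length p) (+ 0)) ⟩
      length (replicate (length p) (+ 0)) ℕ.+ suc (length (replicate (length q) (+ 0)))
        ≡⟨ cong₂ (λ a b → a ℕ.+ suc b) (List.length-replicate (length p))
                                        (List.length-replicate (length q)) ⟩
      length p ℕ.+ suc (length q)
        ≡⟨ List.length-++ p ⟨
      length (p ++ (x ∷ q)) ∎)
  ; at-h = at-++-∷ p
  }
  where
  at-++-∷ : ∀ p i → at (p ++ (x ∷ q)) i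
                  ≡ at (p ++ (+ 0 ∷ q)) i + x * at (basisVector (length p) (length q)) i
  at-++-∷ []      zero    = sym (trans (ℤₚ.+-identityˡ _) (ℤₚ.*-identityʳ x))
  at-++-∷ []      (suc i) = sym (trans (cong (_+_ (at q i)) x*0≡0) (ℤₚ.+-identityʳ _))
    where x*0≡0 = trans (cong (x *_) (at-replicate-0 (length q) i)) (ℤₚ.*-zeroʳ x)
  at-++-∷ (y ∷ p) zero    = sym (trans (cong (_+_ y) (ℤₚ.*-zeroʳ x)) (ℤₚ.+-identityʳ y))
  at-++-∷ (y ∷ p) (suc i) = at-++-∷ p i

slope : ℕ → List ℤ
slope k = basisVector (suc (k ℕ.∸ 1)) (k ℕ.∸ 1)

hkm-linearCombination : ∀ k m → IsLinearCombination (hkm k m) (hkm k 0) (+ m) (slope k)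
hkm-linearCombination k m =
  subst₂ (λ i n → IsLinearCombination (hkm k m) (hkm k 0) (+ m) (basisVector i n))
         (cong suc (List.length-replicate (k ℕ.∸ 1))) (List.length-replicate (k ℕ.∸ 1))
         (++-∷-linearCombination (+ 1 ∷ replicate (k ℕ.∸ 1) (+ 1)) (+ m)
                                 (replicate (k ℕ.∸ 1) (+ 0)))

hkm-quadraticΠ : ∀ k {Tu Te} → let D = top (hkm k 0) ℕ.+ top (hkm k 0) in
  applyUpTo (E (hkm k 0)) (suc D) ≡ Tu → applyUpTo (E (slope k)) (suc D) ≡ Te →
  QuadraticΠ (hkm k 0) (slope k) (ΠOfTables D Tu Tu) (ΠOfTables D Tu Te) (ΠOfTables D Te Te)
hkm-quadraticΠ k = tabulatedQuadraticΠ (hkm k 0) (slope k) (trans top-e (sym top-u))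
  where open IsLinearCombination (hkm-linearCombination k 0)

solutions? : ∀ k {P₀ P₁ P₂} → QuadraticΠ (hkm k 0) (slope k) P₀ P₁ P₂ →
             ∀ m → Dec (Solution (hkm k m))
solutions? k q m = solution? (hkm k m) (unimodalΠ? (hkm-linearCombination k m) q)

AgreesWithListed : ∀ k → (∀ m → Dec (Solution (hkm k m))) → Set
AgreesWithListed k solution? =
  ∀ {m} → m < 101 → 1 ≤ m → does (solution? m) ≡ does (listed? k m)

-- Evaluation shares the arguments of a function: the tables Tu, Te and the vectors P₀, P₁,
-- P₂ are therefore computed once per k, and not once per m.
agreesWithListed? : ∀ k {P₀ P₁ P₂} (q : QuadraticΠ (hkm k 0) (slope k) P₀ P₁ P₂) →
                    Dec (AgreesWithListed k (solutions? k q))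
agreesWithListed? k q =
  ℕₚ.allUpTo? (λ m → 1 ℕ.≤? m →-dec does (solutions? k q m) Bool.≟ does (listed? k m)) 101

agreesWithListedForTables? : ∀ k Tu Te → let D = top (hkm k 0) ℕ.+ top (hkm k 0) in
  (Tu≡ : applyUpTo (E (hkm k 0)) (suc D) ≡ Tu) (Te≡ : applyUpTo (E (slope k)) (suc D) ≡ Te) →
  Dec (AgreesWithListed k (solutions? k (hkm-quadraticΠ k Tu≡ Te≡)))
agreesWithListedForTables? k Tu Te Tu≡ Te≡ = agreesWithListed? k (hkm-quadraticΠ k Tu≡ Te≡)

agreesWithListed : ∀ {k} → k < 21 → 2 ≤ k →
                   AgreesWithListed k (solutions? k (hkm-quadraticΠ k refl refl))
agreesWithListed = Dec.from-yes (ℕₚ.allUpTo? (λ k → 2 ℕ.≤? k →-dec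
  agreesWithListedForTables? k (applyUpTo (E (hkm k 0)) _) (applyUpTo (E (slope k)) _) refl refl)
  21)

proposition3p4 : (k m : ℕ) → 2 ≤ k → k ≤ 20 → 1 ≤ m → m ≤ 100 →
    (Solution (hkm k m) ⇔ Listed k m)
proposition3p4 k m 2≤k k≤20 1≤m m≤100 =
  ⇔-from-does (solutions? k (hkm-quadraticΠ k refl refl) m) (listed? k m)
              (agreesWithListed (s≤s k≤20) 2≤k (s≤s m≤100) 1≤m)
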